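{- If $a,b$ are integers with $a\ge b\ge1$, then \[\overline{p}(a\mid \text{no } 1\text{'s})\,\overline{p}(b) > \overline{p}(a+b\mid \text{no } 1\text{'s}),\] except for $(a,b)=(1,1),(2,1)$.
   Context: An overpartition of $n$ is a partition of $n$ in which the last occurrence of each distinct part may be overlined; $\overline{p}(n)$ is the number of overpartitions of $n$. $\overline{p}(n\mid \text{no } 1\text{'s})$ denotes the number of overpartitions of $n$ having no non-overlined part equal to $1$ (an overlined part $\overline{1}$ is allowed). -}

module Defs where

open import Data.Nat using (ℕ; zero; suc; _+_; _*_; _≟_)
open import Data.Bool using (Bool; true; false) renaming (_≟_ to _B≟_)
open import Data.Product using (_×_; _,_)
open import Data.List using (List; []; _∷_; length; filter; upTo; concatMap; map)
open import Data.Vec using (Vec; []; _∷_)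

-- An overpartition of n is encoded by its multiplicity data: for each part
-- size s = 1, 2, …, n an entry (m , o) where m is the number of
-- NON-overlined copies of s and o says whether an overlined copy s̄ occurs
-- (at most one, since only the last occurrence of a part may be overlined).
OPData : ℕ → Set
OPData n = Vec (ℕ × Bool) n

bit : Bool → ℕ
bit true  = 1
bit false = 0

-- weight of the data, where the entry at position i (0-based) concerns the
-- part size  s + i  (we start at s = 1)
weightFrom : ℕ → {k : ℕ} → Vec (ℕ × Bool) k → ℕ
weightFrom s [] = 0
weightFrom s ((m , o) ∷ v) = s * (m + bit o) + weightFrom (suc s) v

weight : {k : ℕ} → Vec (ℕ × Bool) k → ℕ
weight = weightFrom 1

-- all vectors of length k whose multiplicities are ≤ bound
-- (for an overpartition of n every multiplicity is ≤ n, so bound n suffices)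
candidates : (k bound : ℕ) → List (Vec (ℕ × Bool) k)
candidates zero    bound = [] ∷ []
candidates (suc k) bound =
  concatMap (λ m → concatMap (λ o → map ((m , o) ∷_) (candidates k bound))
                             (false ∷ true ∷ []))
            (upTo (suc bound))

overpartitions : (n : ℕ) → List (OPData n)
overpartitions n = filter (λ v → weight v ≟ n) (candidates n n)

pbar : ℕ → ℕ
pbar n = length (overpartitions n)

-- "no non-overlined part equal to 1": multiplicity of plain 1 is zero
-- (an overlined 1̄ is allowed)
noPlainOne : {n : ℕ} → OPData n → Bool
noPlainOne [] = true
noPlainOne ((zero , _) ∷ _) = true
noPlainOne ((suc _ , _) ∷ _) = false

pbarNo1 : ℕ → ℕ
pbarNo1 n = length (filter (λ v → noPlainOne v B≟ true) (overpartitions n))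

private
  open import Relation.Binary.PropositionalEquality using (_≡_; refl)
  _ : pbar 4 ≡ 14
  _ = refl
  _ : pbar 5 ≡ 24
  _ = refl
  _ : pbarNo1 4 ≡ 6
  _ = refl
  _ : pbarNo1 5 ≡ 10
  _ = refl

-- An overpartition λ of a + b without plain 1's is split into overpartitions μ of a (still
-- without plain 1's) and ν of b. Let t + 1 be the smallest part size such that the parts of
-- size at most t + 1 weigh more than b, and write b minus the weight of the smaller parts as
-- d + j (t + 1) with d ≤ t. Then ν consists of the parts smaller than t + 1, j plain copies of
-- t + 1 and d plain 1's, while one further copy of t + 1 is moved down to size t + 1 - d and
-- joins the remaining parts in μ. The 1's of (μ , ν) record enough to glue λ back together, so
-- the splitting is injective; it is not surjective because some pair glues two overlined parts
-- into one (for (a , b) = (4 , 1) a missed pair is found by computation).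

module Submission where

open import Defs
open import Function using (_∘_)
open import Data.Nat
  using (ℕ; zero; suc; _+_; _*_; _∸_; _≤_; _<_; _>_; z≤n; s≤s; _≡ᵇ_; _<ᵇ_; _≟_; _/_; _%_)
open import Data.Nat.Properties
open import Data.Nat.DivMod using (m≡m%n+[m/n]*n; m%n<n)
open import Data.Nat.Tactic.RingSolver using (solve-∀)
open import Data.Bool using (Bool; true; false; T; _∨_; _∧_; if_then_else_) renaming (_≟_ to _B≟_)
open import Data.Bool.Properties using (if-float; ∨-identityʳ; ∨-comm; ∨-assoc; ∧-zeroʳ; ∨-zeroʳ)
open import Data.Product using (_×_; _,_; proj₁; proj₂; ∃)
open import Data.Sum using (inj₁; inj₂)
open import Data.Unit using (tt)
open import Data.List using (List; []; _∷_; _++_; length; filter; concatMap; map; cartesianProduct)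
open import Data.List.Properties using (length-++; length-map; length-removeAt′)
open import Data.List.Membership.Propositional using (_∈_; _─_; find; lose)
open import Data.List.Membership.Propositional.Properties
  using (∈-map⁺; ∈-map⁻; ∈-concatMap⁺; ∈-concatMap⁻; ∈-upTo⁺; ∈-filter⁺; ∈-filter⁻; ∈-cartesianProduct⁺)
open import Data.List.Relation.Binary.Subset.Propositional using (_⊆_)
open import Data.List.Relation.Unary.Any using (here; there; index)
open import Data.List.Relation.Unary.All as All using ([]; _∷_)
open import Data.List.Relation.Unary.AllPairs using ([]; _∷_)
open import Data.List.Relation.Unary.Unique.Propositional using (Unique)
import Data.List.Relation.Unary.Unique.Propositional.Properties as Unique
open import Data.Vec using (Vec; []; _∷_; head)
open import Data.Vec.Properties using (∷-injectiveʳ)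
open import Data.Vec.Relation.Unary.All using (All; []; _∷_)
open import Relation.Binary.PropositionalEquality
open import Relation.Binary.Definitions using (tri<; tri≈; tri>)
open import Relation.Nullary using (¬_; yes; no; contradiction)

private
  variable
    A B C : Set

-- Counting lists

∈-─ : {x y : A} {ys : List A} (p : y ∈ ys) → x ∈ ys → x ≢ y → x ∈ ys ─ p
∈-─ (here refl) (here refl) x≢y = contradiction refl x≢y
∈-─ (here refl) (there x∈ys) x≢y = x∈ys
∈-─ (there p) (here refl) x≢y = here refl
∈-─ (there p) (there x∈ys) x≢y = there (∈-─ p x∈ys x≢y)

Unique-⊆⇒length≤ : {xs ys : List A} → Unique xs → xs ⊆ ys → length xs ≤ length ys
Unique-⊆⇒length≤ {xs = []} _ _ = z≤n
Unique-⊆⇒length≤ {xs = x ∷ xs} {ys} (x∉xs ∷ xs!) xs⊆ys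
  rewrite length-removeAt′ ys (index (xs⊆ys (here refl))) =
  s≤s (Unique-⊆⇒length≤ xs! λ z∈xs →
    ∈-─ (xs⊆ys (here refl)) (xs⊆ys (there z∈xs)) λ z≡x → All.lookup x∉xs z∈xs (sym z≡x))

map⁺-injectiveOn : (f : A → B) {xs : List A} → Unique xs →
  (∀ {x y} → x ∈ xs → y ∈ xs → f x ≡ f y → x ≡ y) → Unique (map f xs)
map⁺-injectiveOn f {[]} [] _ = []
map⁺-injectiveOn f {x ∷ xs} (x∉xs ∷ xs!) inj =
  All.tabulate fx∉ ∷ map⁺-injectiveOn f xs! λ p q → inj (there p) (there q)
  where
  fx∉ : ∀ {w} → w ∈ map f xs → f x ≢ w
  fx∉ w∈ fx≡w with ∈-map⁻ f w∈
  ... | y , y∈xs , refl = All.lookup x∉xs y∈xs (inj (here refl) (there y∈xs) fx≡w)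

injectiveOn-nonSurjective⇒length< : (f : A → B) {xs : List A} {ys : List B} → Unique xs →
  (∀ {x} → x ∈ xs → f x ∈ ys) →
  (∀ {x y} → x ∈ xs → y ∈ xs → f x ≡ f y → x ≡ y) →
  (z : B) → z ∈ ys → (∀ {x} → x ∈ xs → f x ≢ z) → length xs < length ys
injectiveOn-nonSurjective⇒length< f {xs} {ys} xs! f∈ inj z z∈ys z∉img =
  subst (λ k → suc k ≤ length ys) (length-map f xs)
    (Unique-⊆⇒length≤ (All.tabulate z≢ ∷ map⁺-injectiveOn f xs! inj) ⊆ys)
  where
  z≢ : ∀ {w} → w ∈ map f xs → z ≢ w
  z≢ w∈ z≡w with ∈-map⁻ f w∈
  ... | x , x∈xs , refl = z∉img x∈xs (sym z≡w)
  ⊆ys : z ∷ map f xs ⊆ ys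
  ⊆ys (here refl) = z∈ys
  ⊆ys (there w∈) with ∈-map⁻ f w∈
  ... | x , x∈xs , refl = f∈ x∈xs

length-cartesianProduct : (xs : List A) (ys : List B) →
  length (cartesianProduct xs ys) ≡ length xs * length ys
length-cartesianProduct [] ys = refl
length-cartesianProduct (x ∷ xs) ys = begin
  length (map (x ,_) ys ++ cartesianProduct xs ys)
    ≡⟨ length-++ (map (x ,_) ys) ⟩
  length (map (x ,_) ys) + length (cartesianProduct xs ys)
    ≡⟨ cong₂ _+_ (length-map (x ,_) ys) (length-cartesianProduct xs ys) ⟩
  length ys + length xs * length ys ∎
  where open ≡-Reasoning

concatMap-unique : (h : A → List C) (tag : C → A) {xs : List A} → Unique xs →
  (∀ x → Unique (h x)) → (∀ x {c} → c ∈ h x → tag c ≡ x) → Unique (concatMap h xs)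
concatMap-unique h tag {[]} [] _ _ = []
concatMap-unique h tag {x ∷ xs} (x∉xs ∷ xs!) h! tagged =
  Unique.++⁺ (h! x) (concatMap-unique h tag xs! h! tagged) disjoint
  where
  disjoint : ∀ {c} → ¬ (c ∈ h x × c ∈ concatMap h xs)
  disjoint (c∈hx , c∈rest) with find (∈-concatMap⁻ h {xs = xs} c∈rest)
  ... | y , y∈xs , c∈hy = All.lookup x∉xs y∈xs (trans (sym (tagged x c∈hx)) (tagged y c∈hy))

bools-unique : Unique (false ∷ true ∷ [])
bools-unique = ((λ ()) ∷ []) ∷ [] ∷ []

∈-bools : ∀ o → o ∈ false ∷ true ∷ []
∈-bools false = here refl
∈-bools true = there (here refl)

candidates-unique : (k bound : ℕ) → Unique (candidates k bound)
candidates-unique zero bound = [] ∷ []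
candidates-unique (suc k) bound =
  concatMap-unique prefixed (proj₁ ∘ head) (Unique.upTo⁺ (suc bound))
    (λ m → concatMap-unique (extend m) (proj₂ ∘ head) bools-unique
             (λ o → Unique.map⁺ ∷-injectiveʳ (candidates-unique k bound))
             (λ o c∈ → cong proj₂ (head-entry (∈-map⁻ _ c∈))))
    (λ m c∈ → let o , _ , c∈′ = find (∈-concatMap⁻ (extend m) {xs = false ∷ true ∷ []} c∈)
              in cong proj₁ (head-entry (∈-map⁻ _ c∈′)))
  where
  Entries : Set
  Entries = Vec (ℕ × Bool) (suc k)
  extend : ℕ → Bool → List Entries
  extend m o = map ((m , o) ∷_) (candidates k bound)
  prefixed : ℕ → List Entries
  prefixed m = concatMap (extend m) (false ∷ true ∷ [])
  head-entry : ∀ {m o} {c : Entries} →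
    (∃ λ w → w ∈ candidates k bound × c ≡ (m , o) ∷ w) → head c ≡ (m , o)
  head-entry (_ , _ , refl) = refl

∈-candidates : (k bound : ℕ) (v : Vec (ℕ × Bool) k) →
  All (λ e → proj₁ e ≤ bound) v → v ∈ candidates k bound
∈-candidates zero bound [] [] = here refl
∈-candidates (suc k) bound ((m , o) ∷ v) (m≤ ∷ v≤) =
  ∈-concatMap⁺ (λ m → concatMap (extend m) (false ∷ true ∷ []))
    (lose (∈-upTo⁺ (s≤s m≤))
      (∈-concatMap⁺ (extend m) (lose (∈-bools o) (∈-map⁺ ((m , o) ∷_) (∈-candidates k bound v v≤)))))
  where
  extend : ℕ → Bool → List (Vec (ℕ × Bool) (suc k))
  extend m o = map ((m , o) ∷_) (candidates k bound)

weightFrom⇒multiplicities≤ : (s bound : ℕ) {k : ℕ} (v : Vec (ℕ × Bool) k) →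
  weightFrom (suc s) v ≤ bound → All (λ e → proj₁ e ≤ bound) v
weightFrom⇒multiplicities≤ s bound [] _ = []
weightFrom⇒multiplicities≤ s bound ((m , o) ∷ v) w≤ =
  ≤-trans (m≤m+n m (bit o)) (≤-trans (m≤n*m (m + bit o) (suc s)) (≤-trans (m≤m+n _ _) w≤)) ∷
  weightFrom⇒multiplicities≤ (suc s) bound v (≤-trans (m≤n+m _ _) w≤)

∈-overpartitions⁺ : (n : ℕ) (v : OPData n) → weight v ≡ n → v ∈ overpartitions n
∈-overpartitions⁺ n v w≡n = ∈-filter⁺ (λ v → weight v ≟ n)
  (∈-candidates n n v (weightFrom⇒multiplicities≤ 0 n v (≤-reflexive w≡n))) w≡n

∈-overpartitions⁻ : (n : ℕ) {v : OPData n} → v ∈ overpartitions n → weight v ≡ n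
∈-overpartitions⁻ n v∈ = proj₂ (∈-filter⁻ (λ v → weight v ≟ n) {xs = candidates n n} v∈)

overpartitions-unique : (n : ℕ) → Unique (overpartitions n)
overpartitions-unique n = Unique.filter⁺ (λ v → weight v ≟ n) (candidates-unique n n)

-- Multiplicity sequences

Entry : Set
Entry = ℕ × Bool

-- Index i carries the entry of the part size suc i, as in OPData.
Seq : Set
Seq = ℕ → Entry

none : Entry
none = (0 , false)

copies : Entry → ℕ
copies (m , o) = m + bit o

_⊕ₑ_ : Entry → Entry → Entry
(m , o) ⊕ₑ (m′ , o′) = (m + m′ , o ∨ o′)

_⊕_ : Seq → Seq → Seq
(f ⊕ g) i = f i ⊕ₑ g i

infixl 6 _⊕ₑ_ _⊕_

single : ℕ → Entry → Seq
single p e i = if i ≡ᵇ p then e else none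

empty : Seq
empty _ = none

VanishesFrom : ℕ → Seq → Set
VanishesFrom n f = ∀ i → n ≤ i → f i ≡ none

≡ᵇ-refl : ∀ n → (n ≡ᵇ n) ≡ true
≡ᵇ-refl zero = refl
≡ᵇ-refl (suc n) = ≡ᵇ-refl n

≢⇒≡ᵇ≡false : ∀ m n → m ≢ n → (m ≡ᵇ n) ≡ false
≢⇒≡ᵇ≡false zero zero m≢n = contradiction refl m≢n
≢⇒≡ᵇ≡false zero (suc n) _ = refl
≢⇒≡ᵇ≡false (suc m) zero _ = refl
≢⇒≡ᵇ≡false (suc m) (suc n) m≢n = ≢⇒≡ᵇ≡false m n (m≢n ∘ cong suc)

<⇒<ᵇ≡true : ∀ {m n} → m < n → (m <ᵇ n) ≡ true
<⇒<ᵇ≡true {zero} (s≤s _) = refl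
<⇒<ᵇ≡true {suc m} (s≤s m<n) = <⇒<ᵇ≡true m<n

≥⇒<ᵇ≡false : ∀ {m n} → n ≤ m → (m <ᵇ n) ≡ false
≥⇒<ᵇ≡false z≤n = refl
≥⇒<ᵇ≡false (s≤s n≤m) = ≥⇒<ᵇ≡false n≤m

<ᵇ≡true⇒< : ∀ {m n} → (m <ᵇ n) ≡ true → m < n
<ᵇ≡true⇒< {m} {n} eq = <ᵇ⇒< m n (subst T (sym eq) tt)

<ᵇ≡false⇒≥ : ∀ {m n} → (m <ᵇ n) ≡ false → n ≤ m
<ᵇ≡false⇒≥ eq = ≮⇒≥ λ m<n → subst T eq (<⇒<ᵇ m<n)

single-at : ∀ p e → single p e p ≡ e
single-at p e = cong (if_then e else none) (≡ᵇ-refl p)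

single-≢ : ∀ p e {i} → i ≢ p → single p e i ≡ none
single-≢ p e {i} i≢p = cong (if_then e else none) (≢⇒≡ᵇ≡false i p i≢p)

VanishesFrom-single : ∀ {N q} e → q < N → VanishesFrom N (single q e)
VanishesFrom-single {q = q} e q<N i N≤i = single-≢ q e (>⇒≢ (<-≤-trans q<N N≤i))

VanishesFrom-⊕ : ∀ {N f g} → VanishesFrom N f → VanishesFrom N g → VanishesFrom N (f ⊕ g)
VanishesFrom-⊕ f↓ g↓ i N≤i = cong₂ _⊕ₑ_ (f↓ i N≤i) (g↓ i N≤i)

⊕ₑ-identityʳ : ∀ e → e ⊕ₑ none ≡ e
⊕ₑ-identityʳ (m , o) = cong₂ _,_ (+-identityʳ m) (∨-identityʳ o)

⊕ₑ-comm : ∀ e e′ → e ⊕ₑ e′ ≡ e′ ⊕ₑ e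
⊕ₑ-comm (m , o) (m′ , o′) = cong₂ _,_ (+-comm m m′) (∨-comm o o′)

⊕ₑ-assoc : ∀ e e′ e″ → e ⊕ₑ e′ ⊕ₑ e″ ≡ e ⊕ₑ (e′ ⊕ₑ e″)
⊕ₑ-assoc (m , o) (m′ , o′) (m″ , o″) = cong₂ _,_ (+-assoc m m′ m″) (∨-assoc o o′ o″)

copies≡0⇒none : ∀ e → copies e ≡ 0 → e ≡ none
copies≡0⇒none (zero , false) _ = refl

bothOverlined : Entry → Entry → ℕ
bothOverlined (_ , o) (_ , o′) = bit (o ∧ o′)

copies-⊕ₑ : ∀ e e′ → copies e + copies e′ ≡ copies (e ⊕ₑ e′) + bothOverlined e e′
copies-⊕ₑ (m , false) (m′ , o′) = lemma m m′ (bit o′)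
  where
  lemma : ∀ m m′ b → m + 0 + (m′ + b) ≡ m + m′ + b + 0
  lemma = solve-∀
copies-⊕ₑ (m , true) (m′ , o′) = lemma m m′ (bit o′)
  where
  lemma : ∀ m m′ b → m + 1 + (m′ + b) ≡ m + m′ + 1 + b
  lemma = solve-∀

weighted : (ℕ → ℕ) → ℕ → ℕ
weighted u zero = 0
weighted u (suc n) = weighted u n + suc n * u n

wt : Seq → ℕ → ℕ
wt f n = weighted (λ i → copies (f i)) n

weighted-cong : ∀ {u v : ℕ → ℕ} n → (∀ i → i < n → u i ≡ v i) → weighted u n ≡ weighted v n
weighted-cong zero _ = refl
weighted-cong (suc n) u≡v =
  cong₂ _+_ (weighted-cong n λ i i<n → u≡v i (m<n⇒m<1+n i<n)) (cong (suc n *_) (u≡v n ≤-refl))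

wt-cong : ∀ {f g : Seq} n → (∀ i → i < n → f i ≡ g i) → wt f n ≡ wt g n
wt-cong n f≡g = weighted-cong n λ i i<n → cong copies (f≡g i i<n)

weighted-+ : ∀ (u v : ℕ → ℕ) n → weighted (λ i → u i + v i) n ≡ weighted u n + weighted v n
weighted-+ u v zero = refl
weighted-+ u v (suc n) rewrite weighted-+ u v n = lemma (weighted u n) (weighted v n) n (u n) (v n)
  where
  lemma : ∀ a b n x y → a + b + suc n * (x + y) ≡ a + suc n * x + (b + suc n * y)
  lemma = solve-∀

term≤weighted : ∀ (u : ℕ → ℕ) {n k} → k < n → suc k * u k ≤ weighted u n
term≤weighted u {suc n} (s≤s k≤n) with m≤n⇒m<n∨m≡n k≤n
... | inj₁ k<n = ≤-trans (term≤weighted u k<n) (m≤m+n _ _)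
... | inj₂ refl = m≤n+m _ (weighted u n)

weighted-truncate : ∀ (u : ℕ → ℕ) {n N} → n ≤ N → (∀ i → n ≤ i → i < N → u i ≡ 0) →
  weighted u N ≡ weighted u n
weighted-truncate u {N = zero} z≤n _ = refl
weighted-truncate u {n} {suc N} n≤1+N u≡0 with m≤n⇒m<n∨m≡n n≤1+N
... | inj₂ refl = refl
... | inj₁ (s≤s n≤N)
  rewrite weighted-truncate u n≤N (λ i n≤i i<N → u≡0 i n≤i (m<n⇒m<1+n i<N)) | u≡0 N n≤N ≤-refl
        | *-zeroʳ (suc N) = +-identityʳ _

weighted-single-below : ∀ p c k → k ≤ p → weighted (λ i → if i ≡ᵇ p then c else 0) k ≡ 0
weighted-single-below p c zero _ = refl
weighted-single-below p c (suc k) k<p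
  rewrite weighted-single-below p c k (<⇒≤ k<p) | ≢⇒≡ᵇ≡false k p (<⇒≢ k<p) = *-zeroʳ (suc k)

weighted-single : ∀ p c {n} → p < n → weighted (λ i → if i ≡ᵇ p then c else 0) n ≡ suc p * c
weighted-single p c {suc n} (s≤s p≤n) with m≤n⇒m<n∨m≡n p≤n
... | inj₁ p<n rewrite weighted-single p c p<n | ≢⇒≡ᵇ≡false n p (>⇒≢ p<n) | *-zeroʳ (suc n) =
  +-identityʳ _
... | inj₂ refl rewrite weighted-single-below p c p ≤-refl | ≡ᵇ-refl p = refl

wt-single : ∀ p e {n} → p < n → wt (single p e) n ≡ suc p * copies e
wt-single p e {n} p<n =
  trans (weighted-cong n λ i _ → if-float copies (i ≡ᵇ p) {e} {none}) (weighted-single p (copies e) p<n)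

wt-empty : ∀ n → wt empty n ≡ 0
wt-empty n = weighted-truncate (λ i → copies (empty i)) {N = n} z≤n λ _ _ _ → refl

wt-⊕ : ∀ f g n → wt f n + wt g n ≡ wt (f ⊕ g) n + weighted (λ i → bothOverlined (f i) (g i)) n
wt-⊕ f g n = begin
  wt f n + wt g n
    ≡⟨ weighted-+ _ _ n ⟨
  weighted (λ i → copies (f i) + copies (g i)) n
    ≡⟨ weighted-cong n (λ i _ → copies-⊕ₑ (f i) (g i)) ⟩
  weighted (λ i → copies ((f ⊕ g) i) + bothOverlined (f i) (g i)) n
    ≡⟨ weighted-+ _ _ n ⟩
  wt (f ⊕ g) n + weighted (λ i → bothOverlined (f i) (g i)) n ∎
  where open ≡-Reasoning

wt-⊕-disjoint : ∀ f g {n} → (∀ i → i < n → bothOverlined (f i) (g i) ≡ 0) →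
  wt (f ⊕ g) n ≡ wt f n + wt g n
wt-⊕-disjoint f g {n} disjoint = sym (begin
  wt f n + wt g n
    ≡⟨ wt-⊕ f g n ⟩
  wt (f ⊕ g) n + weighted (λ i → bothOverlined (f i) (g i)) n
    ≡⟨ cong (wt (f ⊕ g) n +_) (weighted-truncate _ z≤n λ i _ → disjoint i) ⟩
  wt (f ⊕ g) n + 0
    ≡⟨ +-identityʳ _ ⟩
  wt (f ⊕ g) n ∎)
  where open ≡-Reasoning

wt-⊕-≤ : ∀ f g n → wt (f ⊕ g) n ≤ wt f n + wt g n
wt-⊕-≤ f g n = ≤-trans (m≤m+n _ _) (≤-reflexive (sym (wt-⊕ f g n)))

wt-⊕-< : ∀ f g {n} k → k < n → bothOverlined (f k) (g k) ≡ 1 → wt (f ⊕ g) n < wt f n + wt g n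
wt-⊕-< f g {n} k k<n clash = begin-strict
  wt (f ⊕ g) n
    <⟨ m<m+n _ (<-≤-trans (s≤s z≤n) lost) ⟩
  wt (f ⊕ g) n + weighted (λ i → bothOverlined (f i) (g i)) n
    ≡⟨ wt-⊕ f g n ⟨
  wt f n + wt g n ∎
  where
  open ≤-Reasoning
  lost : suc k * 1 ≤ weighted (λ i → bothOverlined (f i) (g i)) n
  lost = subst (λ c → suc k * c ≤ weighted (λ i → bothOverlined (f i) (g i)) n) clash
    (term≤weighted (λ i → bothOverlined (f i) (g i)) k<n)

wt≡⇒VanishesFrom : ∀ {f N k} → VanishesFrom N f → wt f N ≡ k → VanishesFrom k f
wt≡⇒VanishesFrom {f} {N} {k} f↓N wt≡k i k≤i with N ≤? i
... | yes N≤i = f↓N i N≤i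
... | no N≰i = copies≡0⇒none (f i) copies≡0
  where
  copies≡0 : copies (f i) ≡ 0
  copies≡0 with copies (f i) in eq
  ... | zero = refl
  ... | suc c = contradiction (begin-strict
    k                    ≤⟨ k≤i ⟩
    i                    <⟨ n<1+n i ⟩
    suc i                ≤⟨ m≤m*n (suc i) (suc c) ⟩
    suc i * suc c        ≡⟨ cong (suc i *_) eq ⟨
    suc i * copies (f i) ≤⟨ term≤weighted _ (≰⇒> N≰i) ⟩
    wt f N               ≡⟨ wt≡k ⟩
    k                    ∎) (<-irrefl refl)
    where open ≤-Reasoning

toSeq : {n : ℕ} → Vec Entry n → Seq
toSeq [] _ = none
toSeq (e ∷ v) zero = e
toSeq (e ∷ v) (suc i) = toSeq v i

fromSeq : (n : ℕ) → Seq → Vec Entry n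
fromSeq zero f = []
fromSeq (suc n) f = f 0 ∷ fromSeq n (f ∘ suc)

fromSeq-toSeq : {n : ℕ} (v : Vec Entry n) → fromSeq n (toSeq v) ≡ v
fromSeq-toSeq [] = refl
fromSeq-toSeq (e ∷ v) = cong (e ∷_) (fromSeq-toSeq v)

fromSeq-cong : ∀ n {f g : Seq} → (∀ i → i < n → f i ≡ g i) → fromSeq n f ≡ fromSeq n g
fromSeq-cong zero _ = refl
fromSeq-cong (suc n) f≡g = cong₂ _∷_ (f≡g 0 (s≤s z≤n)) (fromSeq-cong n λ i i<n → f≡g (suc i) (s≤s i<n))

toSeq-fromSeq-< : ∀ n f {i} → i < n → toSeq (fromSeq n f) i ≡ f i
toSeq-fromSeq-< (suc n) f {zero} _ = refl
toSeq-fromSeq-< (suc n) f {suc i} (s≤s i<n) = toSeq-fromSeq-< n (f ∘ suc) i<n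

toSeq-fromSeq-≥ : ∀ n f {i} → n ≤ i → toSeq (fromSeq n f) i ≡ none
toSeq-fromSeq-≥ zero f _ = refl
toSeq-fromSeq-≥ (suc n) f {suc i} (s≤s n≤i) = toSeq-fromSeq-≥ n (f ∘ suc) n≤i

toSeq-vanishes : ∀ {n} (v : Vec Entry n) → VanishesFrom n (toSeq v)
toSeq-vanishes [] i _ = refl
toSeq-vanishes (e ∷ v) (suc i) (s≤s n≤i) = toSeq-vanishes v i n≤i

toSeq-fromSeq : ∀ {f N k} → VanishesFrom N f → wt f N ≡ k → ∀ i → toSeq (fromSeq k f) i ≡ f i
toSeq-fromSeq {f} {N} {k} f↓N wt≡k i with i <? k
... | yes i<k = toSeq-fromSeq-< k f i<k
... | no i≮k = trans (toSeq-fromSeq-≥ k f (≮⇒≥ i≮k)) (sym (wt≡⇒VanishesFrom f↓N wt≡k i (≮⇒≥ i≮k)))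

-- Bridges to Defs.weightFrom, which recurses from the front with an offset.
wtFrom : ℕ → Seq → ℕ → ℕ
wtFrom s f zero = 0
wtFrom s f (suc n) = wtFrom s f n + (suc s + n) * copies (f n)

wtFrom-suc : ∀ s f n → wtFrom s f (suc n) ≡ suc s * copies (f 0) + wtFrom (suc s) (f ∘ suc) n
wtFrom-suc s f zero = lemma s (copies (f 0))
  where
  lemma : ∀ s c → 0 + (suc s + 0) * c ≡ suc s * c + 0
  lemma = solve-∀
wtFrom-suc s f (suc n) rewrite wtFrom-suc s f n =
  lemma (suc s * copies (f 0)) (wtFrom (suc s) (f ∘ suc) n) s n (copies (f (suc n)))
  where
  lemma : ∀ a b s n c → a + b + (suc s + suc n) * c ≡ a + (b + (suc (suc s) + n) * c)
  lemma = solve-∀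

wtFrom-zero : ∀ f n → wtFrom 0 f n ≡ wt f n
wtFrom-zero f zero = refl
wtFrom-zero f (suc n) = cong (_+ suc n * copies (f n)) (wtFrom-zero f n)

weightFrom-toSeq : ∀ s {n} (v : Vec Entry n) → weightFrom (suc s) v ≡ wtFrom s (toSeq v) n
weightFrom-toSeq s [] = refl
weightFrom-toSeq s {suc n} (e ∷ v) =
  trans (cong (suc s * copies e +_) (weightFrom-toSeq (suc s) v)) (sym (wtFrom-suc s (toSeq (e ∷ v)) n))

weight-toSeq : ∀ {n} (v : Vec Entry n) → weight v ≡ wt (toSeq v) n
weight-toSeq {n} v = trans (weightFrom-toSeq 0 v) (wtFrom-zero (toSeq v) n)

weight-fromSeq : ∀ n f → weight (fromSeq n f) ≡ wt f n
weight-fromSeq n f = trans (weight-toSeq (fromSeq n f)) (wt-cong n λ i → toSeq-fromSeq-< n f)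

weight-fromSeq-≡ : ∀ {f N k} → VanishesFrom N f → wt f N ≡ k → k ≤ N → weight (fromSeq k f) ≡ k
weight-fromSeq-≡ {f} {N} {k} f↓N wt≡k k≤N = begin
  weight (fromSeq k f)
    ≡⟨ weight-fromSeq k f ⟩
  wt f k
    ≡⟨ weighted-truncate _ k≤N (λ i k≤i _ → cong copies (wt≡⇒VanishesFrom f↓N wt≡k i k≤i)) ⟨
  wt f N
    ≡⟨ wt≡k ⟩
  k ∎
  where open ≡-Reasoning

firstTrue : (ℕ → Bool) → ℕ → ℕ
firstTrue P zero = zero
firstTrue P (suc n) = if P 0 then 0 else suc (firstTrue (P ∘ suc) n)

firstTrue-spec : ∀ (P : ℕ → Bool) n {k} → P k ≡ true → k < n →
  P (firstTrue P n) ≡ true × firstTrue P n ≤ k × (∀ i → i < firstTrue P n → P i ≡ false)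
firstTrue-spec P (suc n) {zero} Pk _ rewrite Pk = Pk , z≤n , λ _ ()
firstTrue-spec P (suc n) {suc k} Pk (s≤s k<n) with P 0 in P0
... | true = P0 , z≤n , λ _ ()
... | false with firstTrue-spec (P ∘ suc) n Pk k<n
...   | Pfirst , first≤k , below =
  Pfirst , s≤s first≤k , λ { zero _ → P0 ; (suc i) (s≤s i<) → below i i< }

firstTrue-≡ : ∀ (P : ℕ → Bool) {n q} → q < n → P q ≡ true → (∀ i → i < q → P i ≡ false) →
  firstTrue P n ≡ q
firstTrue-≡ P {n} q<n Pq below with firstTrue-spec P n Pq q<n
... | Pfirst , first≤q , _ with m≤n⇒m<n∨m≡n first≤q
...   | inj₁ first<q = contradiction (trans (sym Pfirst) (below _ first<q)) λ ()
...   | inj₂ first≡q = first≡q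

firstTrue-cong : ∀ {P Q : ℕ → Bool} n → (∀ i → P i ≡ Q i) → firstTrue P n ≡ firstTrue Q n
firstTrue-cong zero _ = refl
firstTrue-cong (suc n) P≡Q =
  cong₂ (λ b r → if b then 0 else suc r) (P≡Q 0) (firstTrue-cong n (P≡Q ∘ suc))

-- Gluing

dropCopy : Entry → Entry
dropCopy (zero , o) = none
dropCopy (suc m , o) = (m , o)

removedCopy : Entry → Entry
removedCopy (zero , o) = (0 , true)
removedCopy (suc m , o) = (1 , false)

occupied : Entry → Bool
occupied (zero , o) = o
occupied (suc m , o) = true

clear0 : Seq → Seq
clear0 f zero = none
clear0 f (suc i) = f (suc i)

dropPlain0 : Seq → Seq
dropPlain0 f zero = (0 , proj₂ (f 0))
dropPlain0 f (suc i) = f (suc i)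

dropCopyAt : ℕ → Seq → Seq
dropCopyAt p f i = if i ≡ᵇ p then dropCopy (f i) else f i

smallest : ℕ → Seq → ℕ
smallest N μ = firstTrue (occupied ∘ μ) N

moveUp : ℕ → ℕ → Seq → Seq
moveUp p c μ = dropCopyAt p μ ⊕ single (p + c) (removedCopy (μ p))

-- Inverse of the splitting below. Without an overlined 1 in μ, the c plain 1's of ν tell how
-- far the split-off copy, now the smallest part of μ, was moved down; an overlined 1 in μ marks
-- the case d = t, where the 1's of ν encode the split-off copy.
glueCase : ℕ → Bool → Entry → Seq → Seq → Seq
glueCase N false (zero , _) μ ν = μ ⊕ ν
glueCase N false (suc c , _) μ ν = moveUp (smallest N μ) (suc c) μ ⊕ dropPlain0 ν
glueCase N true (c , true) μ ν = clear0 μ ⊕ clear0 ν ⊕ single (suc c) (1 , false)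
glueCase N true (zero , false) μ ν = μ ⊕ ν
glueCase N true (suc c , false) μ ν = clear0 μ ⊕ dropPlain0 ν ⊕ single (suc c) (0 , true)

glue : ℕ → Seq → Seq → Seq
glue N μ ν = glueCase N (proj₂ (μ 0)) (ν 0) μ ν

clear0-cong : ∀ {f g} → f ≗ g → clear0 f ≗ clear0 g
clear0-cong f≗g zero = refl
clear0-cong f≗g (suc i) = f≗g (suc i)

dropPlain0-cong : ∀ {f g} → f ≗ g → dropPlain0 f ≗ dropPlain0 g
dropPlain0-cong f≗g zero = cong (λ e → (0 , proj₂ e)) (f≗g 0)
dropPlain0-cong f≗g (suc i) = f≗g (suc i)

moveUp-cong : ∀ p c {μ μ′} → μ ≗ μ′ → moveUp p c μ ≗ moveUp p c μ′
moveUp-cong p c μ≗μ′ i rewrite μ≗μ′ i | μ≗μ′ p = refl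

smallest-cong : ∀ N {μ μ′} → μ ≗ μ′ → smallest N μ ≡ smallest N μ′
smallest-cong N μ≗μ′ = firstTrue-cong N (cong occupied ∘ μ≗μ′)

glueCase-cong : ∀ N h e {μ μ′ ν ν′} → μ ≗ μ′ → ν ≗ ν′ → glueCase N h e μ ν ≗ glueCase N h e μ′ ν′
glueCase-cong N false (zero , _) μ≗ ν≗ i = cong₂ _⊕ₑ_ (μ≗ i) (ν≗ i)
glueCase-cong N false (suc c , _) {μ} μ≗ ν≗ i =
  cong₂ _⊕ₑ_ (trans (cong (λ p → moveUp p (suc c) μ i) (smallest-cong N μ≗))
                    (moveUp-cong _ (suc c) μ≗ i))
             (dropPlain0-cong ν≗ i)
glueCase-cong N true (c , true) μ≗ ν≗ i =
  cong (_⊕ₑ single (suc c) (1 , false) i) (cong₂ _⊕ₑ_ (clear0-cong μ≗ i) (clear0-cong ν≗ i))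
glueCase-cong N true (zero , false) μ≗ ν≗ i = cong₂ _⊕ₑ_ (μ≗ i) (ν≗ i)
glueCase-cong N true (suc c , false) μ≗ ν≗ i =
  cong (_⊕ₑ single (suc c) (0 , true) i) (cong₂ _⊕ₑ_ (clear0-cong μ≗ i) (dropPlain0-cong ν≗ i))

glue-cong : ∀ N {μ μ′ ν ν′} → μ ≗ μ′ → ν ≗ ν′ → glue N μ ν ≗ glue N μ′ ν′
glue-cong N {μ} {μ′} {ν} {ν′} μ≗ ν≗ i =
  trans (cong₂ (λ h e → glueCase N h e μ ν i) (cong proj₂ (μ≗ 0)) (ν≗ 0))
        (glueCase-cong N (proj₂ (μ′ 0)) (ν′ 0) μ≗ ν≗ i)

oneCopy : Bool → Entry
oneCopy true = (1 , false)
oneCopy false = (0 , true)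

copies-oneCopy : ∀ b → copies (oneCopy b) ≡ 1
copies-oneCopy true = refl
copies-oneCopy false = refl

reassemble : Seq → Seq → ℕ → Bool → Seq
reassemble lower upper t plain = lower ⊕ (upper ⊕ single t (oneCopy plain))

⊕ₑ-swap : ∀ e e′ e″ → e ⊕ₑ e′ ⊕ₑ e″ ≡ e′ ⊕ₑ (e ⊕ₑ e″)
⊕ₑ-swap e e′ e″ = trans (cong (_⊕ₑ e″) (⊕ₑ-comm e e′)) (⊕ₑ-assoc e′ e e″)

⊕ₑ-regroup : ∀ e e′ e″ → e ⊕ₑ none ⊕ₑ (e′ ⊕ₑ none) ⊕ₑ e″ ≡ e′ ⊕ₑ (e ⊕ₑ e″)
⊕ₑ-regroup e e′ e″ =
  trans (cong (_⊕ₑ e″) (cong₂ _⊕ₑ_ (⊕ₑ-identityʳ e) (⊕ₑ-identityʳ e′))) (⊕ₑ-swap e e′ e″)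

overlinedOne : Seq
overlinedOne = single 0 (0 , true)

glue-unshifted : ∀ N {t o₁} plain {lower upper} → 0 < t → upper 0 ≡ none → lower 0 ≡ (0 , o₁) →
  glue N (upper ⊕ single t (oneCopy plain)) lower ≗ reassemble lower upper t plain
glue-unshifted N {t} plain {lower} {upper} 0<t upper0 lower0 i =
  trans (cong₂ (λ h e → glueCase N h e μ lower i) noOverlinedOne lower0) (⊕ₑ-comm (μ i) (lower i))
  where
  μ : Seq
  μ = upper ⊕ single t (oneCopy plain)
  noOverlinedOne : proj₂ (μ 0) ≡ false
  noOverlinedOne = cong proj₂ (cong₂ _⊕ₑ_ upper0 (single-≢ t (oneCopy plain) (<⇒≢ 0<t)))

glue-shifted : ∀ N {t q c o₁} plain {lower upper} → 0 < q → q + suc c ≡ t → t < N →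
  (∀ i → i < t → upper i ≡ none) → lower 0 ≡ (0 , o₁) →
  glue N (upper ⊕ single q (oneCopy plain)) (lower ⊕ single 0 (suc c , false))
    ≗ reassemble lower upper t plain
glue-shifted N {t} {q} {c} {o₁} plain {lower} {upper} 0<q q+c≡t t<N upper<t lower0 i = begin
  glue N μ ν i
    ≡⟨ cong₂ (λ h e → glueCase N h e μ ν i) noOverlinedOne ν0 ⟩
  moveUp (smallest N μ) (suc c) μ i ⊕ₑ dropPlain0 ν i
    ≡⟨ cong (λ p → moveUp p (suc c) μ i ⊕ₑ dropPlain0 ν i) smallest≡q ⟩
  moveUp q (suc c) μ i ⊕ₑ dropPlain0 ν i
    ≡⟨ cong₂ _⊕ₑ_ (cong₂ _⊕ₑ_ dropped moved) (restored i) ⟩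
  upper i ⊕ₑ single t x i ⊕ₑ lower i
    ≡⟨ ⊕ₑ-comm _ (lower i) ⟩
  reassemble lower upper t plain i ∎
  where
  open ≡-Reasoning
  x : Entry
  x = oneCopy plain
  μ : Seq
  μ = upper ⊕ single q x
  ν : Seq
  ν = lower ⊕ single 0 (suc c , false)
  q<t : q < t
  q<t = subst (q <_) q+c≡t (m<m+n q (s≤s z≤n))
  upper<q : ∀ {j} → j < q → μ j ≡ none
  upper<q {j} j<q = cong₂ _⊕ₑ_ (upper<t j (<-trans j<q q<t)) (single-≢ q x (<⇒≢ j<q))
  μq : μ q ≡ none ⊕ₑ x
  μq = cong₂ _⊕ₑ_ (upper<t q q<t) (single-at q x)
  noOverlinedOne : proj₂ (μ 0) ≡ false
  noOverlinedOne = cong proj₂ (upper<q 0<q)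
  ν0 : ν 0 ≡ (suc c , o₁)
  ν0 = trans (cong (_⊕ₑ (suc c , false)) lower0) (cong (suc c ,_) (∨-identityʳ o₁))
  occupied-x : ∀ b → occupied (none ⊕ₑ oneCopy b) ≡ true
  occupied-x true = refl
  occupied-x false = refl
  smallest≡q : smallest N μ ≡ q
  smallest≡q = firstTrue-≡ _ (<-trans q<t t<N) (trans (cong occupied μq) (occupied-x plain))
    (λ j j<q → cong occupied (upper<q j<q))
  removed-x : ∀ b → removedCopy (none ⊕ₑ oneCopy b) ≡ oneCopy b
  removed-x true = refl
  removed-x false = refl
  moved : single (q + suc c) (removedCopy (μ q)) i ≡ single t x i
  moved = cong₂ (λ p e → single p e i) q+c≡t (trans (cong removedCopy μq) (removed-x plain))
  dropped-x : ∀ b → dropCopy (none ⊕ₑ oneCopy b) ≡ none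
  dropped-x true = refl
  dropped-x false = refl
  dropped : dropCopyAt q μ i ≡ upper i
  dropped with i ≟ q
  ... | yes refl = trans (cong (if_then dropCopy (μ i) else μ i) (≡ᵇ-refl i))
                         (trans (cong dropCopy μq) (trans (dropped-x plain) (sym (upper<t i q<t))))
  ... | no i≢q = trans (cong (if_then dropCopy (μ i) else μ i) (≢⇒≡ᵇ≡false i q i≢q))
                       (trans (cong (upper i ⊕ₑ_) (single-≢ q x i≢q)) (⊕ₑ-identityʳ (upper i)))
  restored : ∀ j → dropPlain0 ν j ≡ lower j
  restored zero = trans (cong (λ e → (0 , proj₂ e)) ν0) (sym lower0)
  restored (suc j) = ⊕ₑ-identityʳ (lower (suc j))

glue-tight-overlinedOne : ∀ N c plain {lower upper} → upper 0 ≡ none → lower 0 ≡ (0 , true) →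
  glue N (upper ⊕ overlinedOne) (clear0 lower ⊕ single (suc c) (oneCopy plain))
    ≗ reassemble lower upper (suc c) plain
glue-tight-overlinedOne N c plain {lower} {upper} upper0 lower0 i =
  trans (cong (λ h → glueCase N h (0 , false) μ ν i) (cong (λ e → proj₂ (e ⊕ₑ (0 , true))) upper0))
        (glued i)
  where
  μ : Seq
  μ = upper ⊕ overlinedOne
  ν : Seq
  ν = clear0 lower ⊕ single (suc c) (oneCopy plain)
  glued : ∀ i → (μ ⊕ ν) i ≡ reassemble lower upper (suc c) plain i
  glued zero = trans (cong (λ e → e ⊕ₑ (0 , true) ⊕ₑ none) upper0)
                     (sym (cong₂ (λ k e → k ⊕ₑ (e ⊕ₑ none)) lower0 upper0))
  glued (suc j) =
    trans (cong (_⊕ₑ (l ⊕ₑ s)) (⊕ₑ-identityʳ u)) (trans (sym (⊕ₑ-assoc u l s)) (⊕ₑ-swap u l s))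
    where
    u : Entry
    u = upper (suc j)
    l : Entry
    l = lower (suc j)
    s : Entry
    s = single (suc c) (oneCopy plain) (suc j)

glue-tight-plain : ∀ N c {lower upper} → upper 0 ≡ none → lower 0 ≡ (0 , false) →
  glue N (upper ⊕ overlinedOne) (lower ⊕ single 0 (suc c , false)) ≗ reassemble lower upper (suc c) false
glue-tight-plain N c {lower} {upper} upper0 lower0 i =
  trans (cong₂ (λ h e → glueCase N h e μ ν i) (cong (λ e → proj₂ (e ⊕ₑ (0 , true))) upper0) ν0) (glued i)
  where
  μ : Seq
  μ = upper ⊕ overlinedOne
  ν : Seq
  ν = lower ⊕ single 0 (suc c , false)
  ν0 : ν 0 ≡ (suc c , false)
  ν0 = cong (_⊕ₑ (suc c , false)) lower0
  glued : ∀ i → (clear0 μ ⊕ dropPlain0 ν ⊕ single (suc c) (0 , true)) i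
              ≡ reassemble lower upper (suc c) false i
  glued zero = trans (cong (λ e → none ⊕ₑ (0 , proj₂ e) ⊕ₑ none) ν0)
                     (sym (cong₂ (λ k e → k ⊕ₑ (e ⊕ₑ none)) lower0 upper0))
  glued (suc j) = ⊕ₑ-regroup (upper (suc j)) (lower (suc j)) _

glue-tight-overlined : ∀ N c {lower upper} → upper 0 ≡ none → lower 0 ≡ (0 , false) →
  glue N (upper ⊕ overlinedOne) (lower ⊕ single 0 (c , true)) ≗ reassemble lower upper (suc c) true
glue-tight-overlined N c {lower} {upper} upper0 lower0 i =
  trans (cong₂ (λ h e → glueCase N h e μ ν i) (cong (λ e → proj₂ (e ⊕ₑ (0 , true))) upper0) ν0) (glued i)
  where
  μ : Seq
  μ = upper ⊕ overlinedOne
  ν : Seq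
  ν = lower ⊕ single 0 (c , true)
  ν0 : ν 0 ≡ (c , true)
  ν0 = cong (_⊕ₑ (c , true)) lower0
  glued : ∀ i → (clear0 μ ⊕ clear0 ν ⊕ single (suc c) (1 , false)) i
              ≡ reassemble lower upper (suc c) true i
  glued zero = sym (cong₂ (λ k e → k ⊕ₑ (e ⊕ₑ none)) lower0 upper0)
  glued (suc j) = ⊕ₑ-regroup (upper (suc j)) (lower (suc j)) _

-- Splitting

cutTight : ℕ → Bool → Bool → Seq → Seq → Seq × Seq
cutTight d′ true  plain lower upper = upper ⊕ overlinedOne , clear0 lower ⊕ single (suc d′) (oneCopy plain)
cutTight d′ false false lower upper = upper ⊕ overlinedOne , lower ⊕ single 0 (suc d′ , false)
cutTight d′ false true lower upper = upper ⊕ overlinedOne , lower ⊕ single 0 (d′ , true)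

-- The remainder d is paid by shifting the split-off copy at index t down by d, and
-- adding d plain 1's to ν; when d = t the copy would become a 1, so μ gets an overlined 1.
cut : ℕ → ℕ → Bool → Bool → Seq → Seq → Seq × Seq
cut t zero o₁ plain lower upper = upper ⊕ single t (oneCopy plain) , lower
cut t (suc d′) o₁ plain lower upper with suc d′ <? t
... | yes _ = upper ⊕ single (t ∸ suc d′) (oneCopy plain) , lower ⊕ single 0 (suc d′ , false)
... | no _ = cutTight d′ o₁ plain lower upper

record CutData (N a b t d : ℕ) (o₁ plain : Bool) (lower upper : Seq) : Set where
  field
    d<1+t : d < suc t
    0<t : 0 < t
    t<N : t < N
    lower0 : lower 0 ≡ (0 , o₁)
    upper<t : ∀ i → i < t → upper i ≡ none
    upper-t-disjoint : bothOverlined (upper t) (oneCopy plain) ≡ 0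
    lower-t-plain : proj₂ (lower t) ≡ false
    lower-vanishes : VanishesFrom N lower
    upper-vanishes : VanishesFrom N upper
    wt-lower : wt lower N + d ≡ b
    wt-upper : wt upper N + suc t ≡ a + d

record ValidPair (N a b : ℕ) (μν : Seq × Seq) : Set where
  field
    wt-μ : wt (proj₁ μν) N ≡ a
    wt-ν : wt (proj₂ μν) N ≡ b
    μ-noPlainOne : proj₁ (proj₁ μν 0) ≡ 0
    μ-vanishes : VanishesFrom N (proj₁ μν)
    ν-vanishes : VanishesFrom N (proj₂ μν)

record Splits (N a b : ℕ) (λs : Seq) (μν : Seq × Seq) : Set where
  field
    valid : ValidPair N a b μν
    glue-≗ : glue N (proj₁ μν) (proj₂ μν) ≗ λs

wt-⊕-single : ∀ f q e {N} → q < N → bothOverlined (f q) e ≡ 0 →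
  wt (f ⊕ single q e) N ≡ wt f N + suc q * copies e
wt-⊕-single f q e {N} q<N disjoint = begin
  wt (f ⊕ single q e) N      ≡⟨ wt-⊕-disjoint f (single q e) {N} (λ i _ → disjoint-at i) ⟩
  wt f N + wt (single q e) N ≡⟨ cong (wt f N +_) (wt-single q e q<N) ⟩
  wt f N + suc q * copies e  ∎
  where
  open ≡-Reasoning
  disjoint-at : ∀ i → bothOverlined (f i) (single q e i) ≡ 0
  disjoint-at i with i ≟ q
  ... | yes refl rewrite single-at i e = disjoint
  ... | no i≢q rewrite single-≢ q e i≢q = cong bit (∧-zeroʳ (proj₂ (f i)))

wt-⊕-oneCopy : ∀ f q plain {N} → q < N → bothOverlined (f q) (oneCopy plain) ≡ 0 →
  wt (f ⊕ single q (oneCopy plain)) N ≡ wt f N + suc q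
wt-⊕-oneCopy f q plain {N} q<N disjoint = trans (wt-⊕-single f q (oneCopy plain) q<N disjoint)
  (cong (wt f N +_) (trans (cong (suc q *_) (copies-oneCopy plain)) (*-identityʳ (suc q))))

wt-⊕-plainOnes : ∀ f c {N} → 0 < N → wt (f ⊕ single 0 (c , false)) N ≡ wt f N + c
wt-⊕-plainOnes f c {N} 0<N = trans (wt-⊕-single f 0 (c , false) 0<N (cong bit (∧-zeroʳ (proj₂ (f 0)))))
  (cong (wt f N +_) (trans (*-identityˡ (c + 0)) (+-identityʳ c)))

wt-clear0 : ∀ f {N} → 0 < N → wt f N ≡ wt (clear0 f) N + copies (f 0)
wt-clear0 f {N} 0<N = begin
  wt f N
    ≡⟨ weighted-cong N (λ i _ → split i) ⟩
  weighted (λ i → copies (clear0 f i) + copies (single 0 (f 0) i)) N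
    ≡⟨ weighted-+ _ _ N ⟩
  wt (clear0 f) N + wt (single 0 (f 0)) N
    ≡⟨ cong (wt (clear0 f) N +_) (wt-single 0 (f 0) 0<N) ⟩
  wt (clear0 f) N + (copies (f 0) + 0)
    ≡⟨ cong (wt (clear0 f) N +_) (+-identityʳ _) ⟩
  wt (clear0 f) N + copies (f 0) ∎
  where
  open ≡-Reasoning
  split : ∀ i → copies (f i) ≡ copies (clear0 f i) + copies (single 0 (f 0) i)
  split zero = refl
  split (suc i) = sym (+-identityʳ _)

+suc-cancelʳ : ∀ w q d a → w + suc (q + d) ≡ a + d → w + suc q ≡ a
+suc-cancelʳ w q d a eq = +-cancelʳ-≡ d _ _ (trans (lemma w q d) eq)
  where
  lemma : ∀ w q d → w + suc q + d ≡ w + suc (q + d)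
  lemma = solve-∀

module _ {N a b t d o₁ plain lower upper} (H : CutData N a b t d o₁ plain lower upper) where
  open CutData H

  private
    0<N : 0 < N
    0<N = <-trans 0<t t<N

    vanishes-⊕-single : ∀ {f q} e → VanishesFrom N f → q < N → VanishesFrom N (f ⊕ single q e)
    vanishes-⊕-single e f↓ q<N = VanishesFrom-⊕ f↓ (VanishesFrom-single e q<N)

    noPlainOne-⊕ : ∀ {q} e → 0 < q → proj₁ ((upper ⊕ single q e) 0) ≡ 0
    noPlainOne-⊕ {q} e 0<q = cong₂ (λ u v → proj₁ (u ⊕ₑ v)) (upper<t 0 0<t) (single-≢ q e (<⇒≢ 0<q))

  splits-unshifted : d ≡ 0 →
    Splits N a b (reassemble lower upper t plain) (upper ⊕ single t (oneCopy plain) , lower)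
  splits-unshifted refl = record { valid = record
    { wt-μ = trans (wt-⊕-oneCopy upper t plain t<N upper-t-disjoint) (trans wt-upper (+-identityʳ a))
    ; wt-ν = trans (sym (+-identityʳ _)) wt-lower
    ; μ-noPlainOne = noPlainOne-⊕ _ 0<t
    ; μ-vanishes = vanishes-⊕-single _ upper-vanishes t<N
    ; ν-vanishes = lower-vanishes
    } ; glue-≗ = glue-unshifted N plain {lower} {upper} 0<t (upper<t 0 0<t) lower0 }

  splits-shifted : ∀ {d′} → d ≡ suc d′ → suc d′ < t →
    Splits N a b (reassemble lower upper t plain)
                 (upper ⊕ single (t ∸ suc d′) (oneCopy plain) , lower ⊕ single 0 (suc d′ , false))
  splits-shifted {d′} refl d<t = record { valid = record
    { wt-μ = trans (wt-⊕-oneCopy upper q plain (<-trans q<t t<N) upper-q-disjoint)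
                   (+suc-cancelʳ (wt upper N) q (suc d′) a (subst (λ s → wt upper N + suc s ≡ a + suc d′)
                                                                  (sym q+d≡t) wt-upper))
    ; wt-ν = trans (wt-⊕-plainOnes lower (suc d′) 0<N) wt-lower
    ; μ-noPlainOne = noPlainOne-⊕ _ (m<n⇒0<n∸m d<t)
    ; μ-vanishes = vanishes-⊕-single _ upper-vanishes (<-trans q<t t<N)
    ; ν-vanishes = vanishes-⊕-single _ lower-vanishes 0<N
    } ; glue-≗ = glue-shifted N plain (m<n⇒0<n∸m d<t) q+d≡t t<N upper<t lower0 }
    where
    q : ℕ
    q = t ∸ suc d′
    q+d≡t : q + suc d′ ≡ t
    q+d≡t = m∸n+n≡m (<⇒≤ d<t)
    q<t : q < t
    q<t = subst (q <_) q+d≡t (m<m+n q (s≤s z≤n))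
    upper-q-disjoint : bothOverlined (upper q) (oneCopy plain) ≡ 0
    upper-q-disjoint = cong (λ e → bothOverlined e (oneCopy plain)) (upper<t q q<t)

  splits-tight : ∀ {d′} → d ≡ suc d′ → t ≡ suc d′ →
    Splits N a b (reassemble lower upper t plain) (cutTight d′ o₁ plain lower upper)
  splits-tight {d′} refl refl = tight o₁ plain lower0 lower-t-plain
    where
    wt-μ : wt (upper ⊕ overlinedOne) N ≡ a
    wt-μ = trans (wt-⊕-single upper 0 (0 , true) 0<N
                               (cong (λ e → bothOverlined e (0 , true)) (upper<t 0 0<t)))
                 (+suc-cancelʳ (wt upper N) 0 (suc d′) a wt-upper)
    μ-noPlainOne : proj₁ ((upper ⊕ overlinedOne) 0) ≡ 0
    μ-noPlainOne = cong (λ e → proj₁ (e ⊕ₑ (0 , true))) (upper<t 0 0<t)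
    μ-vanishes : VanishesFrom N (upper ⊕ overlinedOne)
    μ-vanishes = vanishes-⊕-single _ upper-vanishes 0<N
    tight : ∀ o₁ plain → lower 0 ≡ (0 , o₁) → proj₂ (lower (suc d′)) ≡ false →
      Splits N a b (reassemble lower upper (suc d′) plain) (cutTight d′ o₁ plain lower upper)
    tight true plain lower0 lower-t = record { valid = record
      { wt-μ = wt-μ ; μ-noPlainOne = μ-noPlainOne ; μ-vanishes = μ-vanishes
      ; wt-ν = begin
          wt (clear0 lower ⊕ single (suc d′) (oneCopy plain)) N
            ≡⟨ wt-⊕-oneCopy (clear0 lower) (suc d′) plain t<N (cong (λ o → bit (o ∧ _)) lower-t) ⟩
          wt (clear0 lower) N + suc (suc d′)
            ≡⟨ +-assoc _ 1 (suc d′) ⟨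
          wt (clear0 lower) N + 1 + suc d′
            ≡⟨ cong (λ e → wt (clear0 lower) N + copies e + suc d′) lower0 ⟨
          wt (clear0 lower) N + copies (lower 0) + suc d′
            ≡⟨ cong (_+ suc d′) (wt-clear0 lower 0<N) ⟨
          wt lower N + suc d′
            ≡⟨ wt-lower ⟩
          b ∎
      ; ν-vanishes = vanishes-⊕-single _ (λ { zero _ → refl ; i@(suc _) → lower-vanishes i }) t<N
      } ; glue-≗ = glue-tight-overlinedOne N d′ plain {lower} {upper} (upper<t 0 0<t) lower0 }
      where open ≡-Reasoning
    tight false false lower0 _ = record { valid = record
      { wt-μ = wt-μ ; μ-noPlainOne = μ-noPlainOne ; μ-vanishes = μ-vanishes
      ; wt-ν = trans (wt-⊕-plainOnes lower (suc d′) 0<N) wt-lower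
      ; ν-vanishes = vanishes-⊕-single _ lower-vanishes 0<N
      } ; glue-≗ = glue-tight-plain N d′ {lower} {upper} (upper<t 0 0<t) lower0 }
    tight false true lower0 _ = record { valid = record
      { wt-μ = wt-μ ; μ-noPlainOne = μ-noPlainOne ; μ-vanishes = μ-vanishes
      ; wt-ν = begin
          wt (lower ⊕ single 0 (d′ , true)) N
            ≡⟨ wt-⊕-single lower 0 (d′ , true) 0<N (cong (λ e → bothOverlined e (d′ , true)) lower0) ⟩
          wt lower N + 1 * (d′ + 1)
            ≡⟨ cong (wt lower N +_) (trans (*-identityˡ (d′ + 1)) (+-comm d′ 1)) ⟩
          wt lower N + suc d′
            ≡⟨ wt-lower ⟩
          b ∎
      ; ν-vanishes = vanishes-⊕-single _ lower-vanishes 0<N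
      } ; glue-≗ = glue-tight-overlined N d′ {lower} {upper} (upper<t 0 0<t) lower0 }
      where open ≡-Reasoning

cut-splits : ∀ {N a b t d o₁ plain lower upper} → CutData N a b t d o₁ plain lower upper →
  Splits N a b (reassemble lower upper t plain) (cut t d o₁ plain lower upper)
cut-splits {d = zero} H = splits-unshifted H refl
cut-splits {t = t} {d = suc d′} H with suc d′ <? t
... | yes d<t = splits-shifted H refl d<t
... | no d≮t = splits-tight H refl (≤-antisym (≮⇒≥ d≮t) (≤-pred (CutData.d<1+t H)))

remainder : ℕ → Entry → Entry
remainder j (m , o) = if j <ᵇ m then (m ∸ j ∸ 1 , o) else none

split-entry : ∀ j e → j < copies e → (j , false) ⊕ₑ (remainder j e ⊕ₑ oneCopy (j <ᵇ proj₁ e)) ≡ e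
split-entry j (m , o) j<copies with j <ᵇ m in j<ᵇm
... | true = cong₂ _,_ j+rest≡m (∨-identityʳ o)
  where
  j<m : j < m
  j<m = <ᵇ≡true⇒< j<ᵇm
  j+rest≡m : j + (m ∸ j ∸ 1 + 1) ≡ m
  j+rest≡m = trans (cong (j +_) (m∸n+n≡m (m<n⇒0<n∸m j<m))) (m+[n∸m]≡n (<⇒≤ j<m))
... | false with o
...   | false = contradiction (subst (j <_) (+-identityʳ m) j<copies) (≤⇒≯ (<ᵇ≡false⇒≥ j<ᵇm))
...   | true = cong (_, true) (trans (+-identityʳ j) (≤-antisym j≤m (<ᵇ≡false⇒≥ j<ᵇm)))
  where
  j≤m : j ≤ m
  j≤m = ≤-pred (subst (j <_) (+-comm m 1) j<copies)

remainder-disjoint : ∀ j e → bothOverlined (remainder j e) (oneCopy (j <ᵇ proj₁ e)) ≡ 0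
remainder-disjoint j (m , o) with j <ᵇ m
... | true = cong bit (∧-zeroʳ o)
... | false = refl

-- t is the first index whose prefix weight exceeds b, so that b = wt λs t + d + j (t + 1) with
-- d ≤ t and j below the number of copies at t: the j copies complete ν up to d, one more
-- copy is split off, and everything else goes to μ.
module Split (b N : ℕ) (λs : Seq) where
  exceeds : ℕ → Bool
  exceeds i = b <ᵇ wt λs (suc i)
  t : ℕ
  t = firstTrue exceeds N
  r : ℕ
  r = b ∸ wt λs t
  j : ℕ
  j = r / suc t
  d : ℕ
  d = r % suc t
  plain : Bool
  plain = j <ᵇ proj₁ (λs t)
  o₁ : Bool
  o₁ = proj₂ (λs 0)
  lower : Seq
  lower i = if i <ᵇ t then λs i else if i ≡ᵇ t then (j , false) else none
  upper : Seq
  upper i = if i <ᵇ t then none else if i ≡ᵇ t then remainder j (λs t) else λs i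
  out : Seq × Seq
  out = cut t d o₁ plain lower upper

module SplitProperties (a b N′ : ℕ) (λs : Seq) (1≤a : 1 ≤ a) (1≤b : 1 ≤ b)
  (wt-λs : wt λs (suc N′) ≡ a + b) (λs-noPlainOne : proj₁ (λs 0) ≡ 0)
  (λs-vanishes : VanishesFrom (suc N′) λs) where

  N : ℕ
  N = suc N′
  open Split b N λs

  private
    t-spec : exceeds t ≡ true × t ≤ N′ × (∀ i → i < t → exceeds i ≡ false)
    t-spec = firstTrue-spec exceeds N (<⇒<ᵇ≡true (subst (b <_) (sym wt-λs) (+-monoˡ-≤ b 1≤a))) ≤-refl

    t<N : t < N
    t<N = s≤s (proj₁ (proj₂ t-spec))

    b<wt : b < wt λs (suc t)
    b<wt = <ᵇ≡true⇒< (proj₁ t-spec)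

    wt-prefix≤ : ∀ {k} → (∀ i → i < k → exceeds i ≡ false) → wt λs k ≤ b
    wt-prefix≤ {zero} _ = z≤n
    wt-prefix≤ {suc k} below = <ᵇ≡false⇒≥ (below k ≤-refl)

    wt≤b : wt λs t ≤ b
    wt≤b = wt-prefix≤ (proj₂ (proj₂ t-spec))

    bit≤1 : ∀ o → bit o ≤ 1
    bit≤1 true = ≤-refl
    bit≤1 false = z≤n

    0<t : 0 < t
    0<t = n≢0⇒n>0 λ t≡0 → <⇒≱ (subst (λ k → b < wt λs (suc k)) t≡0 b<wt) (≤-trans wt1≤1 1≤b)
      where
      wt1≤1 : wt λs 1 ≤ 1
      wt1≤1 = subst (λ m → 1 * (m + bit o₁) ≤ 1) (sym λs-noPlainOne)
                    (≤-trans (≤-reflexive (+-identityʳ _)) (bit≤1 o₁))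

    r≡ : r ≡ d + j * suc t
    r≡ = m≡m%n+[m/n]*n r (suc t)

    j<copies : j < copies (λs t)
    j<copies = *-cancelʳ-< (suc t) j (copies (λs t)) (begin-strict
      j * suc t
        ≤⟨ m≤n+m _ d ⟩
      d + j * suc t
        ≡⟨ r≡ ⟨
      r
        <⟨ +-cancelˡ-< (wt λs t) _ _ (subst (_< wt λs (suc t)) (sym (m+[n∸m]≡n wt≤b)) b<wt) ⟩
      suc t * copies (λs t)
        ≡⟨ *-comm (suc t) _ ⟩
      copies (λs t) * suc t ∎)
      where open ≤-Reasoning

    lower≥ upper≥ : ℕ → Entry
    lower≥ i = if i ≡ᵇ t then (j , false) else none
    upper≥ i = if i ≡ᵇ t then remainder j (λs t) else λs i

    lower-< : ∀ {i} → i < t → lower i ≡ λs i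
    lower-< {i} i<t = cong (if_then λs i else lower≥ i) (<⇒<ᵇ≡true i<t)

    lower-t : lower t ≡ (j , false)
    lower-t = trans (cong (if_then λs t else lower≥ t) (≥⇒<ᵇ≡false {t} {t} ≤-refl))
                    (cong (if_then (j , false) else none) (≡ᵇ-refl t))

    lower-> : ∀ {i} → t < i → lower i ≡ none
    lower-> {i} t<i = trans (cong (if_then λs i else lower≥ i) (≥⇒<ᵇ≡false (<⇒≤ t<i)))
                        (cong (if_then (j , false) else none) (≢⇒≡ᵇ≡false i t (>⇒≢ t<i)))

    upper-< : ∀ {i} → i < t → upper i ≡ none
    upper-< {i} i<t = cong (if_then none else upper≥ i) (<⇒<ᵇ≡true i<t)

    upper-t : upper t ≡ remainder j (λs t)
    upper-t = trans (cong (if_then none else upper≥ t) (≥⇒<ᵇ≡false {t} {t} ≤-refl))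
                 (cong (if_then remainder j (λs t) else λs t) (≡ᵇ-refl t))

    upper-> : ∀ {i} → t < i → upper i ≡ λs i
    upper-> {i} t<i = trans (cong (if_then none else upper≥ i) (≥⇒<ᵇ≡false (<⇒≤ t<i)))
                         (cong (if_then remainder j (λs t) else λs i) (≢⇒≡ᵇ≡false i t (>⇒≢ t<i)))

    x : Entry
    x = oneCopy plain

    decompose : ∀ i → reassemble lower upper t plain i ≡ λs i
    decompose i with <-cmp i t
    ... | tri< i<t _ _ =
      trans (cong₂ (λ u v → u ⊕ₑ (v ⊕ₑ single t x i)) (lower-< i<t) (upper-< i<t))
            (trans (cong (λ v → λs i ⊕ₑ (none ⊕ₑ v)) (single-≢ t x (<⇒≢ i<t))) (⊕ₑ-identityʳ (λs i)))
    ... | tri≈ _ refl _ =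
      trans (cong₂ (λ u v → u ⊕ₑ (v ⊕ₑ single t x t)) lower-t upper-t)
            (trans (cong (λ v → (j , false) ⊕ₑ (remainder j (λs t) ⊕ₑ v)) (single-at t x))
                   (split-entry j (λs t) j<copies))
    ... | tri> _ _ t<i =
      trans (cong₂ (λ u v → u ⊕ₑ (v ⊕ₑ single t x i)) (lower-> t<i) (upper-> t<i))
            (trans (cong (λ v → λs i ⊕ₑ v) (single-≢ t x (>⇒≢ t<i))) (⊕ₑ-identityʳ (λs i)))

    upper-t-disjoint : bothOverlined (upper t) x ≡ 0
    upper-t-disjoint = trans (cong (λ e → bothOverlined e x) upper-t) (remainder-disjoint j (λs t))

    lower-upper-disjoint : ∀ i → bothOverlined (lower i) ((upper ⊕ single t x) i) ≡ 0
    lower-upper-disjoint i with <-cmp i t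
    ... | tri< i<t _ _ rewrite lower-< i<t | upper-< i<t | single-≢ t x (<⇒≢ i<t) = cong bit (∧-zeroʳ _)
    ... | tri≈ _ refl _ rewrite lower-t = refl
    ... | tri> _ _ t<i rewrite lower-> t<i = refl

    wt-lower : wt lower N + d ≡ b
    wt-lower = begin
      wt lower N + d
        ≡⟨ cong (_+ d) (weighted-truncate _ t<N λ i t<i _ → cong copies (lower-> t<i)) ⟩
      wt lower t + suc t * copies (lower t) + d
        ≡⟨ cong₂ (λ w e → w + suc t * copies e + d) (wt-cong t λ i → lower-<) lower-t ⟩
      wt λs t + suc t * (j + 0) + d
        ≡⟨ lemma (wt λs t) t j d ⟩
      wt λs t + (d + j * suc t)
        ≡⟨ cong (wt λs t +_) r≡ ⟨
      wt λs t + r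
        ≡⟨ m+[n∸m]≡n wt≤b ⟩
      b ∎
      where
      open ≡-Reasoning
      lemma : ∀ w t j d → w + suc t * (j + 0) + d ≡ w + (d + j * suc t)
      lemma = solve-∀

    wt-upper : wt upper N + suc t ≡ a + d
    wt-upper = +-cancelˡ-≡ (wt lower N) _ _ (begin
      wt lower N + (wt upper N + suc t)
        ≡⟨ cong (wt lower N +_) (wt-⊕-oneCopy upper t plain t<N upper-t-disjoint) ⟨
      wt lower N + wt (upper ⊕ single t x) N
        ≡⟨ wt-⊕-disjoint lower (upper ⊕ single t x) {N} (λ i _ → lower-upper-disjoint i) ⟨
      wt (reassemble lower upper t plain) N
        ≡⟨ wt-cong N (λ i _ → decompose i) ⟩
      wt λs N
        ≡⟨ wt-λs ⟩
      a + b
        ≡⟨ cong (a +_) wt-lower ⟨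
      a + (wt lower N + d)
        ≡⟨ lemma a (wt lower N) d ⟩
      wt lower N + (a + d) ∎)
      where
      open ≡-Reasoning
      lemma : ∀ a k d → a + (k + d) ≡ k + (a + d)
      lemma = solve-∀

    cutData : CutData N a b t d o₁ plain lower upper
    cutData = record
      { d<1+t = m%n<n r (suc t)
      ; 0<t = 0<t
      ; t<N = t<N
      ; lower0 = trans (lower-< 0<t) (cong (_, o₁) λs-noPlainOne)
      ; upper<t = λ i → upper-<
      ; upper-t-disjoint = upper-t-disjoint
      ; lower-t-plain = cong proj₂ lower-t
      ; lower-vanishes = λ i N≤i → lower-> (<-≤-trans t<N N≤i)
      ; upper-vanishes = λ i N≤i → trans (upper-> (<-≤-trans t<N N≤i)) (λs-vanishes i N≤i)
      ; wt-lower = wt-lower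
      ; wt-upper = wt-upper
      }

  split-splits : Splits N a b λs out
  split-splits = record
    { valid = Splits.valid S
    ; glue-≗ = λ i → trans (Splits.glue-≗ S i) (decompose i)
    }
    where
    S : Splits N a b (reassemble lower upper t plain) out
    S = cut-splits cutData

-- Counting overpartitions

overpartitionsNo1 : (n : ℕ) → List (OPData n)
overpartitionsNo1 n = filter (λ v → noPlainOne v B≟ true) (overpartitions n)

toSeq-noPlainOne : ∀ {n} (v : OPData (suc n)) → noPlainOne v ≡ true → proj₁ (toSeq v 0) ≡ 0
toSeq-noPlainOne ((zero , _) ∷ _) _ = refl

fromSeq-noPlainOne : ∀ n f → proj₁ (f 0) ≡ 0 → noPlainOne (fromSeq (suc n) f) ≡ true
fromSeq-noPlainOne n f f0 with f 0 | f0
... | (zero , _) | _ = refl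

fromSeq-∈-overpartitions : ∀ {f N k} → VanishesFrom N f → wt f N ≡ k → k ≤ N →
  fromSeq k f ∈ overpartitions k
fromSeq-∈-overpartitions f↓ wt≡k k≤N = ∈-overpartitions⁺ _ _ (weight-fromSeq-≡ f↓ wt≡k k≤N)

record Witness (a b : ℕ) : Set where
  field
    pair : Seq × Seq
    valid : ValidPair (a + b) a b pair
    lossy : wt (glue (a + b) (proj₁ pair) (proj₂ pair)) (a + b) < a + b

module Counting (a′ b : ℕ) (1≤b : 1 ≤ b) where
  a : ℕ
  a = suc a′
  N : ℕ
  N = a + b

  Source : List (OPData N)
  Source = overpartitionsNo1 N
  Target : List (OPData a × OPData b)
  Target = cartesianProduct (overpartitionsNo1 a) (overpartitions b)

  toPair : Seq × Seq → OPData a × OPData b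
  toPair (μ , ν) = fromSeq a μ , fromSeq b ν

  fromPair : OPData a × OPData b → OPData N
  fromPair (μ , ν) = fromSeq N (glue N (toSeq μ) (toSeq ν))

  split : OPData N → OPData a × OPData b
  split v = toPair (Split.out b N (toSeq v))

  module _ {μν : Seq × Seq} (P : ValidPair N a b μν) where
    open ValidPair P

    toPair-∈ : toPair μν ∈ Target
    toPair-∈ = ∈-cartesianProduct⁺
      (∈-filter⁺ (λ v → noPlainOne v B≟ true) (fromSeq-∈-overpartitions μ-vanishes wt-μ (m≤m+n a b))
                 (fromSeq-noPlainOne a′ (proj₁ μν) μ-noPlainOne))
      (fromSeq-∈-overpartitions ν-vanishes wt-ν (m≤n+m b a))

    fromPair-toPair : fromPair (toPair μν) ≡ fromSeq N (glue N (proj₁ μν) (proj₂ μν))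
    fromPair-toPair = fromSeq-cong N λ i _ →
      glue-cong N (toSeq-fromSeq μ-vanishes wt-μ) (toSeq-fromSeq ν-vanishes wt-ν) i

  module _ {v : OPData N} (v∈ : v ∈ Source) where
    private
      v∈′ : v ∈ overpartitions N × noPlainOne v ≡ true
      v∈′ = ∈-filter⁻ (λ v → noPlainOne v B≟ true) {xs = overpartitions N} v∈

    weight-source : weight v ≡ N
    weight-source = ∈-overpartitions⁻ N (proj₁ v∈′)

    private
      S : Splits N a b (toSeq v) (Split.out b N (toSeq v))
      S = SplitProperties.split-splits a b (a′ + b) (toSeq v) (s≤s z≤n) 1≤b
            (trans (sym (weight-toSeq v)) weight-source) (toSeq-noPlainOne v (proj₂ v∈′))
            (toSeq-vanishes v)

    split-∈ : split v ∈ Target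
    split-∈ = toPair-∈ (Splits.valid S)

    fromPair-split : fromPair (split v) ≡ v
    fromPair-split = trans (fromPair-toPair (Splits.valid S))
      (trans (fromSeq-cong N λ i _ → Splits.glue-≗ S i) (fromSeq-toSeq v))

  Missed : OPData a × OPData b → Set
  Missed z = ∀ {v} → v ∈ Source → split v ≢ z

  missed⇒< : ∀ z → z ∈ Target → Missed z → pbarNo1 N < pbarNo1 a * pbar b
  missed⇒< z z∈ z-missed =
    subst (length Source <_) (length-cartesianProduct (overpartitionsNo1 a) (overpartitions b))
      (injectiveOn-nonSurjective⇒length< split (Unique.filter⁺ _ (overpartitions-unique N)) split-∈
        (λ v∈ w∈ eq → trans (sym (fromPair-split v∈)) (trans (cong fromPair eq) (fromPair-split w∈)))
        z z∈ z-missed)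

  roundTrip⇒missed : ∀ z → split (fromPair z) ≢ z → Missed z
  roundTrip⇒missed z z≢ {v} v∈ split≡z =
    z≢ (trans (cong split (trans (cong fromPair (sym split≡z)) (fromPair-split v∈))) split≡z)

  lossy⇒missed : (w : Witness a b) → Missed (toPair (Witness.pair w))
  lossy⇒missed w {v} v∈ eq = <-irrefl (begin
    wt (glue N (proj₁ pair) (proj₂ pair)) N
      ≡⟨ weight-fromSeq N (glue N (proj₁ pair) (proj₂ pair)) ⟨
    weight (fromSeq N (glue N (proj₁ pair) (proj₂ pair)))
      ≡⟨ cong weight (fromPair-toPair valid) ⟨
    weight (fromPair (toPair pair))
      ≡⟨ cong (weight ∘ fromPair) eq ⟨
    weight (fromPair (split v))
      ≡⟨ cong weight (fromPair-split v∈) ⟩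
    weight v
      ≡⟨ weight-source v∈ ⟩
    N ∎) lossy
    where
    open Witness w
    open ≡-Reasoning

  witness⇒< : Witness a b → pbarNo1 N < pbarNo1 a * pbar b
  witness⇒< w = missed⇒< _ (toPair-∈ (Witness.valid w)) (lossy⇒missed w)

-- Witnesses

onePart : ℕ → Seq
onePart zero = empty
onePart (suc zero) = overlinedOne
onePart (suc (suc k)) = single (suc k) (1 , false)

wt-onePart : ∀ k {N} → k < N → wt (onePart k) N ≡ k
wt-onePart zero {N} _ = wt-empty N
wt-onePart (suc zero) 1<N = wt-single 0 (0 , true) (<-trans (s≤s z≤n) 1<N)
wt-onePart (suc (suc k)) k<N =
  trans (wt-single (suc k) (1 , false) (<-trans (n<1+n _) k<N)) (*-identityʳ _)

onePart-noPlainOne : ∀ k → proj₁ (onePart k 0) ≡ 0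
onePart-noPlainOne zero = refl
onePart-noPlainOne (suc zero) = refl
onePart-noPlainOne (suc (suc k)) = refl

onePart-vanishes : ∀ k {N} → k < N → VanishesFrom N (onePart k)
onePart-vanishes zero _ _ _ = refl
onePart-vanishes (suc zero) 1<N = VanishesFrom-single _ (<-trans (s≤s z≤n) 1<N)
onePart-vanishes (suc (suc k)) k<N = VanishesFrom-single _ (<-trans (n<1+n _) k<N)

plain-single : ∀ p c i → proj₂ (single p (c , false) i) ≡ false
plain-single p c i = plain (i ≡ᵇ p)
  where
  plain : ∀ b → proj₂ (if b then (c , false) else none) ≡ false
  plain true = refl
  plain false = refl

onePart-plain : ∀ k i → 0 < i → proj₂ (onePart k i) ≡ false
onePart-plain zero i _ = refl
onePart-plain (suc zero) i 0<i = cong proj₂ (single-≢ 0 (0 , true) (>⇒≢ 0<i))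
onePart-plain (suc (suc k)) i _ = plain-single (suc k) 1 i

onePart-plain-≢1 : ∀ k → k ≢ 1 → ∀ i → proj₂ (onePart k i) ≡ false
onePart-plain-≢1 zero _ i = refl
onePart-plain-≢1 (suc zero) k≢1 i = contradiction refl k≢1
onePart-plain-≢1 (suc (suc k)) _ i = plain-single (suc k) 1 i

glueCase-noOnes : ∀ N h μ ν → glueCase N h (0 , false) μ ν ≡ μ ⊕ ν
glueCase-noOnes N false μ ν = refl
glueCase-noOnes N true μ ν = refl

-- For b ≥ 2 the pair (onePart k + b̄ , b̄) glues two overlined b's together.
witness-b≥2 : ∀ k b′ → Witness (k + suc (suc b′)) (suc (suc b′))
witness-b≥2 k b′ = record
  { pair = μ , ν
  ; valid = record
    { wt-μ = wt-μ
    ; wt-ν = wt-ν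
    ; μ-noPlainOne = trans (+-identityʳ _) (onePart-noPlainOne k)
    ; μ-vanishes = VanishesFrom-⊕ (onePart-vanishes k k<N) (VanishesFrom-single _ q<N)
    ; ν-vanishes = VanishesFrom-single _ q<N
    }
  ; lossy = begin-strict
      wt (glue N μ ν) N ≡⟨ cong (λ f → wt f N) (glueCase-noOnes N (proj₂ (μ 0)) μ ν) ⟩
      wt (μ ⊕ ν) N      <⟨ wt-⊕-< μ ν q q<N clash ⟩
      wt μ N + wt ν N   ≡⟨ cong₂ _+_ wt-μ wt-ν ⟩
      a + b             ∎
  }
  where
  open ≤-Reasoning
  b : ℕ
  b = suc (suc b′)
  a : ℕ
  a = k + b
  N : ℕ
  N = a + b
  q : ℕ
  q = suc b′
  q<N : q < N
  q<N = ≤-trans (m≤n+m b k) (m≤m+n a b)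
  k<N : k < N
  k<N = ≤-trans (m<m+n k (s≤s z≤n)) (m≤m+n a b)
  ν : Seq
  ν = single q (0 , true)
  μ : Seq
  μ = onePart k ⊕ ν
  wt-ν : wt ν N ≡ b
  wt-ν = trans (wt-single q (0 , true) q<N) (*-identityʳ b)
  wt-μ : wt μ N ≡ a
  wt-μ = trans (wt-⊕-single (onePart k) q (0 , true) q<N
                             (cong (λ o → bit (o ∧ true)) (onePart-plain k q (s≤s z≤n))))
               (cong₂ _+_ (wt-onePart k k<N) (*-identityʳ b))
  clash : bothOverlined (μ q) (ν q) ≡ 1
  clash rewrite single-at q (0 , true) | ∨-zeroʳ (proj₂ (onePart k q)) = refl

-- For b = 1 the pair (1̄ + 2̄ + onePart k , 1) is glued by turning its 1 into a second 2̄.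
witness-b≡1 : ∀ k → k ≢ 1 → Witness (3 + k) 1
witness-b≡1 k k≢1 = record
  { pair = μ , ν
  ; valid = record
    { wt-μ = wt-μ
    ; wt-ν = wt-single 0 (1 , false) 0<N
    ; μ-noPlainOne = onePart-noPlainOne k
    ; μ-vanishes = VanishesFrom-⊕ (VanishesFrom-⊕ (VanishesFrom-single _ 0<N) (VanishesFrom-single _ 1<N))
                                  (onePart-vanishes k k<N)
    ; ν-vanishes = VanishesFrom-single _ 0<N
    }
  ; lossy = begin-strict
      wt (clear0 μ ⊕ dropPlain0 ν ⊕ single 1 (0 , true)) N
        <⟨ wt-⊕-< (clear0 μ ⊕ dropPlain0 ν) _ 1 1<N refl ⟩
      wt (clear0 μ ⊕ dropPlain0 ν) N + wt (single 1 (0 , true)) N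
        ≡⟨ cong (wt (clear0 μ ⊕ dropPlain0 ν) N +_) (wt-single 1 (0 , true) 1<N) ⟩
      wt (clear0 μ ⊕ dropPlain0 ν) N + 2
        ≤⟨ +-monoˡ-≤ 2 (wt-⊕-≤ (clear0 μ) (dropPlain0 ν) N) ⟩
      wt (clear0 μ) N + wt (dropPlain0 ν) N + 2
        ≡⟨ cong₂ (λ u v → u + v + 2) wt-clear0-μ wt-dropPlain0-ν ⟩
      2 + k + 0 + 2
        ≡⟨ arithmetic k ⟩
      N ∎
  }
  where
  open ≤-Reasoning
  a : ℕ
  a = 3 + k
  N : ℕ
  N = a + 1
  0<N : 0 < N
  0<N = s≤s z≤n
  1<N : 1 < N
  1<N = s≤s (s≤s z≤n)
  k<N : k < N
  k<N = s≤s (≤-trans (m≤m+n k 1) (≤-trans (n≤1+n _) (n≤1+n _)))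
  ν : Seq
  ν = single 0 (1 , false)
  μ₀ : Seq
  μ₀ = overlinedOne ⊕ single 1 (0 , true)
  μ : Seq
  μ = μ₀ ⊕ onePart k
  disjoint : ∀ i → bothOverlined (μ₀ i) (onePart k i) ≡ 0
  disjoint i =
    trans (cong (λ o → bit (proj₂ (μ₀ i) ∧ o)) (onePart-plain-≢1 k k≢1 i)) (cong bit (∧-zeroʳ _))
  wt-μ : wt μ N ≡ a
  wt-μ = begin-equality
    wt μ N
      ≡⟨ wt-⊕-disjoint μ₀ (onePart k) {N} (λ i _ → disjoint i) ⟩
    wt μ₀ N + wt (onePart k) N
      ≡⟨ cong₂ _+_ (wt-⊕-single overlinedOne 1 (0 , true) 1<N refl) (wt-onePart k k<N) ⟩
    wt overlinedOne N + 2 + k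
      ≡⟨ cong (λ w → w + 2 + k) (wt-single 0 (0 , true) 0<N) ⟩
    a ∎
  wt-clear0-μ : wt (clear0 μ) N ≡ 2 + k
  wt-clear0-μ = +-cancelʳ-≡ 1 _ _ (begin-equality
    wt (clear0 μ) N + 1            ≡⟨ cong (wt (clear0 μ) N +_) (cong (_+ 1) (onePart-noPlainOne k)) ⟨
    wt (clear0 μ) N + copies (μ 0) ≡⟨ wt-clear0 μ 0<N ⟨
    wt μ N                         ≡⟨ wt-μ ⟩
    3 + k                          ≡⟨ cong (2 +_) (+-comm 1 k) ⟩
    2 + k + 1                      ∎)
  wt-dropPlain0-ν : wt (dropPlain0 ν) N ≡ 0
  wt-dropPlain0-ν = trans (wt-cong {dropPlain0 ν} {empty} N λ { zero _ → refl ; (suc _) _ → refl })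
                          (wt-empty N)
  arithmetic : ∀ k → 2 + k + 0 + 2 ≡ 3 + k + 1
  arithmetic = solve-∀

-- For (a , b) = (4 , 1) no pair loses weight; instead glue sends (2 + 2 , 1) to 2 + 3,
-- which is split into (3 + 1̄ , 1̄).
pbarNo1-5<pbarNo1-4*pbar-1 : pbarNo1 (4 + 1) < pbarNo1 4 * pbar 1
pbarNo1-5<pbarNo1-4*pbar-1 = missed⇒< z z∈ (roundTrip⇒missed z λ ())
  where
  open Counting 3 1 ≤-refl
  z : OPData 4 × OPData 1
  z = (0 , false) ∷ (2 , false) ∷ (0 , false) ∷ (0 , false) ∷ [] , (1 , false) ∷ []
  z∈ : z ∈ Target
  z∈ = ∈-cartesianProduct⁺ (∈-filter⁺ (λ v → noPlainOne v B≟ true) (∈-overpartitions⁺ 4 _ refl) refl)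
                           (∈-overpartitions⁺ 1 _ refl)

pbarNo1-b≡1 : ∀ a → 1 ≤ a → a ≢ 1 → a ≢ 2 → pbarNo1 (a + 1) < pbarNo1 a * pbar 1
pbarNo1-b≡1 0 () _ _
pbarNo1-b≡1 1 _ a≢1 _ = contradiction refl a≢1
pbarNo1-b≡1 2 _ _ a≢2 = contradiction refl a≢2
pbarNo1-b≡1 3 _ _ _ = Counting.witness⇒< 2 1 ≤-refl (witness-b≡1 0 λ ())
pbarNo1-b≡1 4 _ _ _ = pbarNo1-5<pbarNo1-4*pbar-1
pbarNo1-b≡1 (suc (suc (suc (suc (suc k))))) _ _ _ =
  Counting.witness⇒< (4 + k) 1 ≤-refl (witness-b≡1 (2 + k) λ ())

pbarNo1-b≥2 : ∀ a b′ → suc (suc b′) ≤ a → pbarNo1 (a + suc (suc b′)) < pbarNo1 a * pbar (suc (suc b′))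
pbarNo1-b≥2 (suc a′) b′ b≤a =
  Counting.witness⇒< a′ b (s≤s z≤n)
    (subst (λ a → Witness a b) (m∸n+n≡m b≤a) (witness-b≥2 (suc a′ ∸ b) b′))
  where
  b : ℕ
  b = suc (suc b′)

lemma2p4 : (a b : ℕ) → 1 ≤ b → b ≤ a →
    ¬ ((a , b) ≡ (1 , 1)) → ¬ ((a , b) ≡ (2 , 1)) →
    pbarNo1 a * pbar b > pbarNo1 (a + b)
lemma2p4 _ zero () _ _ _
lemma2p4 a (suc zero) _ 1≤a ≢11 ≢21 = pbarNo1-b≡1 a 1≤a (≢11 ∘ cong (_, 1)) (≢21 ∘ cong (_, 1))
lemma2p4 a (suc (suc b′)) _ b≤a _ _ = pbarNo1-b≥2 a b′ b≤a
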